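{- Let $k\geq 2$ be an integer, let $H$ be a graph and $\mathcal{C}_H$ a collection of pairwise disjoint non-empty subsets of $V(H)$ such that for each $D\in\mathcal{C}_H$ we have $\overline{e}_H(D)\leq (k-1)|D|+1$ and $\deg_H(v)\geq k$ for all $v\in D$. Then for every $w\in V_{\leq k-1}(H)$, $$\sum_{\substack{s\in \operatorname{sh}_H(w)\\ \deg_H(s)\leq k-1}}(k-\deg_H(s))\leq (k-1)|\operatorname{sh}_H(w)|-\overline{e}_H(\operatorname{sh}_H(w))+1.$$
   Context: Graphs are finite and simple. $V_{\leq k-1}(H)$ is the set of vertices of $H$ of degree at most $k-1$. For $X\subseteq V(H)$, $\overline{e}_H(X)$ is the number of edges of $H$ incident with at least one vertex of $X$, and $H-X$ is the graph obtained by deleting $X$. A vertex $v$ is adjacent to a set $X$ if it is adjacent to some vertex of $X$. For $w\in V_{\leq k-1}(H)$, the shadow $\operatorname{sh}_H(w)$ (with respect to $\mathcal{C}_H$) is the unique minimal (under inclusion) set $Y\subseteq V(H)$ such that: (I) $w\in Y$; (II) for each $D\in\mathcal{C}_H$, either $D\subseteq Y$ or $D\cap Y=\emptyset$; (III) if $v\in V(H)\setminus Y$ is adjacent to a vertex in $Y$, then $\deg_{H-Y}(v)\geq k$; (IV) if $D\in\mathcal{C}_H$ is adjacent to a vertex in $Y$, then $D\subseteq Y$. -}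

module Defs where

open import Data.Nat using (ℕ; zero; suc; _+_; _*_; _∸_; _≤_; _≤ᵇ_; _<ᵇ_)
open import Data.Bool using (Bool; true; false; if_then_else_; _∧_; _∨_; not)
open import Data.Fin using (Fin; toℕ)
import Data.Fin as F
open import Data.Fin.Subset using (Subset; _∈_; _∉_; _⊆_; ∣_∣)
open import Data.Vec using (lookup)
open import Data.Product using (Σ; ∃; _×_)
open import Data.Sum using (_⊎_)
open import Relation.Binary.PropositionalEquality using (_≡_)

record Graph (n : ℕ) : Set where
  field
    adj    : Fin n → Fin n → Bool
    sym    : ∀ u v → adj u v ≡ adj v u
    irrefl : ∀ v → adj v v ≡ false
open Graph public

sumFin : ∀ {n} → (Fin n → ℕ) → ℕ
sumFin {zero}  f = 0
sumFin {suc n} f = f F.zero + sumFin (λ i → f (F.suc i))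

indicator : Bool → ℕ
indicator b = if b then 1 else 0

deg : ∀ {n} → Graph n → Fin n → ℕ
deg G v = sumFin (λ u → indicator (adj G v u))

degMinus : ∀ {n} → Graph n → Subset n → Fin n → ℕ
degMinus G Y v = sumFin (λ u → indicator (adj G v u ∧ not (lookup Y u)))

-- ē_H(X): number of edges with at least one end in X (each edge {u,v} counted once, u < v)
ebar : ∀ {n} → Graph n → Subset n → ℕ
ebar G X = sumFin (λ u → sumFin (λ v →
  indicator ((toℕ u <ᵇ toℕ v) ∧ adj G u v ∧ (lookup X u ∨ lookup X v))))

AdjTo : ∀ {n} → Graph n → Fin n → Subset n → Set
AdjTo G v X = ∃ λ u → u ∈ X × adj G v u ≡ true

Disjoint : ∀ {n} → Subset n → Subset n → Set
Disjoint D Y = ∀ x → x ∈ D → x ∉ Y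

-- Conditions (I)-(IV) in the definition of the shadow of w (w.r.t. the collection 𝒞)
ShadowConds : ∀ {n} → ℕ → Graph n → (Subset n → Set) → Fin n → Subset n → Set
ShadowConds k G 𝒞 w Y =
  (w ∈ Y)
  × (∀ D → 𝒞 D → (D ⊆ Y ⊎ Disjoint D Y))
  × (∀ v → v ∉ Y → AdjTo G v Y → k ≤ degMinus G Y v)
  × (∀ D → 𝒞 D → (∃ λ x → x ∈ D × AdjTo G x Y) → D ⊆ Y)

IsShadow : ∀ {n} → ℕ → Graph n → (Subset n → Set) → Fin n → Subset n → Set
IsShadow k G 𝒞 w Y =
  ShadowConds k G 𝒞 w Y × (∀ Y' → ShadowConds k G 𝒞 w Y' → Y' ⊆ Y → Y ⊆ Y')

deficitSum : ∀ {n} → ℕ → Graph n → Subset n → ℕ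
deficitSum k G Y = sumFin (λ s →
  if lookup Y s ∧ (deg G s ≤ᵇ k ∸ 1) then k ∸ deg G s else 0)

module Submission where

-- Grow the shadow Y = sh_H(w) from {w} one piece at a time,
-- each piece being either a class D ∈ 𝒞 joined to the current set Z by an
-- edge, or a single vertex v ∈ Y outside every class with a neighbour in Z and
-- fewer than k neighbours outside Z.  Write c = k - 1 and call Z bounded if
--   Σ_{s ∈ Z} (k ∸ deg s) + ē(Z) ≤ c·|Z| + 1,
-- which is the inequality of the lemma (terms with deg s ≥ k vanish).  Since
-- ē(Z ∪ A) = ē(Z) + ē(A) - e(Z, A) for disjoint Z and A, boundedness is kept
-- when the added piece A pays for itself:  Σ_{s ∈ A} (k ∸ deg s) + ē(A) ≤ c·|A| + e(Z, A).
-- Both kinds of pieces do, using e(Z, A) ≥ 1, and {w} is bounded since deg w ≤ c.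
-- A set Z ⊆ Y that admits no further piece satisfies conditions (I)-(IV), so
-- Z = Y by minimality of the shadow; the growth terminates since Z increases.

open import Defs hiding (sym)
open import Data.Nat
  using (ℕ; zero; suc; _≤_; _<_; _∸_; _+_; _*_; _⊔_; _<ᵇ_; _≤ᵇ_; _≤?_; z≤n; s≤s; >-nonZero)
import Data.Nat.Properties as ℕₚ
open import Data.Nat.Tactic.RingSolver using (solve-∀)
open import Data.Integer using (ℤ; +_; _-_) renaming (_≤_ to _≤ℤ_; _+_ to _+ℤ_)
import Data.Integer as ℤ
import Data.Integer.Properties as ℤₚ
import Data.Integer.Tactic.RingSolver as ℤ-Solver
open import Data.Bool using (Bool; true; false; not; _∧_; _∨_; if_then_else_)
import Data.Bool.Properties as Boolₚ
open import Data.Fin using (Fin; zero; suc; toℕ; _≟_)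
import Data.Fin.Properties as Finₚ
open import Data.Fin.Subset using (Subset; _∈_; _∉_; _⊆_; _⊂_; _⊃_; _∪_; ⁅_⁆; ⊥; ∣_∣)
import Data.Fin.Subset.Properties as Subsetₚ
open import Data.Fin.Subset.Induction using (Acc; acc; ⊃-wellFounded)
open import Data.Vec using (lookup; []; _∷_)
import Data.Vec.Properties as Vecₚ
open import Data.Product using (∃; _×_; _,_; proj₁; proj₂)
open import Data.Sum using (_⊎_; inj₁; inj₂; [_,_]′)
open import Data.Empty using (⊥-elim)
open import Relation.Nullary using (¬_; yes; no)
open import Relation.Nullary.Decidable using (decidable-stable)
open import Relation.Nullary.Reflects using (ofʸ; ofⁿ)
open import Relation.Binary.PropositionalEquality
  using (_≡_; _≢_; refl; sym; trans; cong; cong₂; subst; subst₂; module ≡-Reasoning)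
open import Algebra.Properties.CommutativeMonoid.Sum ℕₚ.+-0-commutativeMonoid
  using (sum; sum-cong-≗; ∑-distrib-+; ∑-comm)

sumFin≡sum : ∀ {n} (f : Fin n → ℕ) → sumFin f ≡ sum f
sumFin≡sum {zero}  f = refl
sumFin≡sum {suc n} f = cong (λ s → f zero + s) (sumFin≡sum (λ i → f (suc i)))

sumFin-cong : ∀ {n} {f g : Fin n → ℕ} → (∀ i → f i ≡ g i) → sumFin f ≡ sumFin g
sumFin-cong {f = f} {g} f≗g = begin
  sumFin f ≡⟨ sumFin≡sum f ⟩
  sum f    ≡⟨ sum-cong-≗ f≗g ⟩
  sum g    ≡⟨ sym (sumFin≡sum g) ⟩
  sumFin g ∎
  where open ≡-Reasoning

sumFin-+ : ∀ {n} (f g : Fin n → ℕ) → sumFin (λ i → f i + g i) ≡ sumFin f + sumFin g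
sumFin-+ f g = begin
  sumFin (λ i → f i + g i) ≡⟨ sumFin≡sum (λ i → f i + g i) ⟩
  sum (λ i → f i + g i)    ≡⟨ ∑-distrib-+ f g ⟩
  sum f + sum g            ≡⟨ sym (cong₂ _+_ (sumFin≡sum f) (sumFin≡sum g)) ⟩
  sumFin f + sumFin g      ∎
  where open ≡-Reasoning

sumFin² : ∀ {m n} → (Fin m → Fin n → ℕ) → ℕ
sumFin² f = sumFin (λ i → sumFin (f i))

sumFin²≡sum : ∀ {m n} (f : Fin m → Fin n → ℕ) → sumFin² f ≡ sum (λ i → sum (f i))
sumFin²≡sum f = trans (sumFin≡sum (λ i → sumFin (f i))) (sum-cong-≗ (λ i → sumFin≡sum (f i)))

sumFin²-+ : ∀ {m n} (f g : Fin m → Fin n → ℕ) →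
  sumFin² (λ i j → f i j + g i j) ≡ sumFin² f + sumFin² g
sumFin²-+ f g = trans (sumFin-cong (λ i → sumFin-+ (f i) (g i)))
                      (sumFin-+ (λ i → sumFin (f i)) (λ i → sumFin (g i)))

sumFin²-swap : ∀ {m n} (f : Fin m → Fin n → ℕ) → sumFin² f ≡ sumFin² (λ j i → f i j)
sumFin²-swap f = begin
  sumFin² f                         ≡⟨ sumFin²≡sum f ⟩
  sum (λ i → sum (f i))             ≡⟨ ∑-comm f ⟩
  sum (λ j → sum (λ i → f i j))     ≡⟨ sym (sumFin²≡sum (λ j i → f i j)) ⟩
  sumFin² (λ j i → f i j)           ∎
  where open ≡-Reasoning

sumFin-zeros : ∀ {n} (f : Fin n → ℕ) → (∀ i → f i ≡ 0) → sumFin f ≡ 0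
sumFin-zeros {zero}  f f≡0 = refl
sumFin-zeros {suc n} f f≡0 = cong₂ _+_ (f≡0 zero) (sumFin-zeros _ (λ i → f≡0 (suc i)))

sumFin-mono : ∀ {n} {f g : Fin n → ℕ} → (∀ i → f i ≤ g i) → sumFin f ≤ sumFin g
sumFin-mono {zero}  f≤g = z≤n
sumFin-mono {suc n} f≤g = ℕₚ.+-mono-≤ (f≤g zero) (sumFin-mono (λ i → f≤g (suc i)))

sumFin-term : ∀ {n} (f : Fin n → ℕ) (i : Fin n) → f i ≤ sumFin f
sumFin-term f zero    = ℕₚ.m≤m+n _ _
sumFin-term f (suc i) = ℕₚ.≤-trans (sumFin-term (λ j → f (suc j)) i) (ℕₚ.m≤n+m _ (f zero))

sumFin-if : ∀ {n} (b : Bool) (f : Fin n → ℕ) →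
  sumFin (λ i → if b then f i else 0) ≡ (if b then sumFin f else 0)
sumFin-if {n} true  f = refl
sumFin-if {n} false f = sumFin-zeros {n} (λ _ → 0) (λ _ → refl)

twice : ∀ m → m * 2 ≡ m + m
twice = solve-∀

∈⇒lookup : ∀ {n} {x : Fin n} {p : Subset n} → x ∈ p → lookup p x ≡ true
∈⇒lookup = Vecₚ.[]=⇒lookup

lookup⇒∈ : ∀ {n} {x : Fin n} {p : Subset n} → lookup p x ≡ true → x ∈ p
lookup⇒∈ = Vecₚ.lookup⇒[]= _ _

∉⇒lookup : ∀ {n} {x : Fin n} {p : Subset n} → x ∉ p → lookup p x ≡ false
∉⇒lookup {x = x} {p} x∉p with lookup p x in eq
... | true  = ⊥-elim (x∉p (lookup⇒∈ eq))
... | false = refl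

lookup-∪ : ∀ {n} (p q : Subset n) (x : Fin n) → lookup (p ∪ q) x ≡ lookup p x ∨ lookup q x
lookup-∪ p q x = Vecₚ.lookup-zipWith _∨_ x p q

disjoint-sym : ∀ {n} {p q : Subset n} → Disjoint p q → Disjoint q p
disjoint-sym p#q x x∈q x∈p = p#q x x∈p x∈q

disjoint⇒∧≡false : ∀ {n} {p q : Subset n} → Disjoint p q → ∀ x → lookup p x ∧ lookup q x ≡ false
disjoint⇒∧≡false {p = p} p#q x with lookup p x in eq
... | true  = ∉⇒lookup (p#q x (lookup⇒∈ eq))
... | false = refl

sumOver : ∀ {n} → Subset n → (Fin n → ℕ) → ℕ
sumOver X f = sumFin (λ u → if lookup X u then f u else 0)

if-∨ : ∀ (a b : Bool) (m : ℕ) → a ∧ b ≡ false →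
  (if a ∨ b then m else 0) ≡ (if a then m else 0) + (if b then m else 0)
if-∨ true  false m _ = sym (ℕₚ.+-identityʳ m)
if-∨ false b     m _ = refl

sumOver-∪ : ∀ {n} {X A : Subset n} (f : Fin n → ℕ) → Disjoint X A →
  sumOver (X ∪ A) f ≡ sumOver X f + sumOver A f
sumOver-∪ {n} {X} {A} f X#A = trans (sumFin-cong split) (sumFin-+ {n} _ _)
  where
  split : ∀ u → (if lookup (X ∪ A) u then f u else 0)
              ≡ (if lookup X u then f u else 0) + (if lookup A u then f u else 0)
  split u rewrite lookup-∪ X A u = if-∨ (lookup X u) (lookup A u) (f u) (disjoint⇒∧≡false X#A u)

sumOver-⊥ : ∀ {n} (f : Fin n → ℕ) → sumOver ⊥ f ≡ 0
sumOver-⊥ {zero}  f = refl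
sumOver-⊥ {suc n} f = sumOver-⊥ (λ u → f (suc u))

sumOver-⁅⁆ : ∀ {n} (f : Fin n → ℕ) (v : Fin n) → sumOver ⁅ v ⁆ f ≡ f v
sumOver-⁅⁆ f zero    = trans (cong (λ s → f zero + s) (sumOver-⊥ (λ u → f (suc u)))) (ℕₚ.+-identityʳ _)
sumOver-⁅⁆ f (suc v) = sumOver-⁅⁆ (λ u → f (suc u)) v

sumOver-cong : ∀ {n} (X : Subset n) {f g : Fin n → ℕ} → (∀ u → u ∈ X → f u ≡ g u) →
  sumOver X f ≡ sumOver X g
sumOver-cong X {f} {g} f≗g = sumFin-cong pointwise
  where
  pointwise : ∀ u → (if lookup X u then f u else 0) ≡ (if lookup X u then g u else 0)
  pointwise u with lookup X u in eq
  ... | true  = f≗g u (lookup⇒∈ eq)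
  ... | false = refl

sumOver-+ : ∀ {n} (X : Subset n) (f g : Fin n → ℕ) →
  sumOver X (λ u → f u + g u) ≡ sumOver X f + sumOver X g
sumOver-+ {n} X f g = trans (sumFin-cong pointwise) (sumFin-+ {n} _ _)
  where
  pointwise : ∀ u → (if lookup X u then f u + g u else 0)
                  ≡ (if lookup X u then f u else 0) + (if lookup X u then g u else 0)
  pointwise u with lookup X u
  ... | true  = refl
  ... | false = refl

sumOver-term : ∀ {n} {X : Subset n} (f : Fin n → ℕ) {u : Fin n} → u ∈ X → f u ≤ sumOver X f
sumOver-term {X = X} f {u} u∈X =
  subst (λ b → (if b then f u else 0) ≤ sumOver X f) (∈⇒lookup u∈X)
        (sumFin-term (λ v → if lookup X v then f v else 0) u)

sumOver-vanishes : ∀ {n} (X : Subset n) {f : Fin n → ℕ} → (∀ u → u ∈ X → f u ≡ 0) → sumOver X f ≡ 0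
sumOver-vanishes X f≡0 = trans (sumOver-cong X f≡0) (sumFin-zeros _ if-0)
  where
  if-0 : ∀ u → (if lookup X u then 0 else 0) ≡ 0
  if-0 u with lookup X u
  ... | true  = refl
  ... | false = refl

∣∣≡sumOver : ∀ {n} (X : Subset n) → ∣ X ∣ ≡ sumOver X (λ _ → 1)
∣∣≡sumOver []          = refl
∣∣≡sumOver (true ∷ X)  = cong suc (∣∣≡sumOver X)
∣∣≡sumOver (false ∷ X) = ∣∣≡sumOver X

∣∪∣ : ∀ {n} {X A : Subset n} → Disjoint X A → ∣ X ∪ A ∣ ≡ ∣ X ∣ + ∣ A ∣
∣∪∣ {X = X} {A} X#A = begin
  ∣ X ∪ A ∣                                   ≡⟨ ∣∣≡sumOver (X ∪ A) ⟩
  sumOver (X ∪ A) (λ _ → 1)                   ≡⟨ sumOver-∪ (λ _ → 1) X#A ⟩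
  sumOver X (λ _ → 1) + sumOver A (λ _ → 1)   ≡⟨ sym (cong₂ _+_ (∣∣≡sumOver X) (∣∣≡sumOver A)) ⟩
  ∣ X ∣ + ∣ A ∣                               ∎
  where open ≡-Reasoning

module Counting {n : ℕ} (G : Graph n) where

  nbrs : Subset n → Fin n → ℕ
  nbrs A u = sumFin (λ v → indicator (adj G u v ∧ lookup A v))

  cross : Subset n → Subset n → ℕ
  cross Z A = sumOver Z (nbrs A)

  degree-split : ∀ Z u → deg G u ≡ degMinus G Z u + nbrs Z u
  degree-split Z u = trans (sumFin-cong (λ v → split (adj G u v) (lookup Z v))) (sumFin-+ {n} _ _)
    where
    split : ∀ a z → indicator a ≡ indicator (a ∧ not z) + indicator (a ∧ z)
    split true  true  = refl
    split true  false = refl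
    split false z     = refl

  degMinus-∪ : ∀ {Z A} → Disjoint Z A → ∀ u → degMinus G (Z ∪ A) u + nbrs A u ≡ degMinus G Z u
  degMinus-∪ {Z} {A} Z#A u = trans (sym (sumFin-+ {n} _ _)) (sumFin-cong pointwise)
    where
    split : ∀ a z b → z ∧ b ≡ false → indicator (a ∧ not (z ∨ b)) + indicator (a ∧ b) ≡ indicator (a ∧ not z)
    split false z     b     _ = refl
    split true  true  false _ = refl
    split true  false true  _ = refl
    split true  false false _ = refl
    pointwise : ∀ v → indicator (adj G u v ∧ not (lookup (Z ∪ A) v)) + indicator (adj G u v ∧ lookup A v)
                    ≡ indicator (adj G u v ∧ not (lookup Z v))
    pointwise v rewrite lookup-∪ Z A v =
      split (adj G u v) (lookup Z v) (lookup A v) (disjoint⇒∧≡false Z#A v)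

  degMinus-antitone : ∀ {Z Y} → Z ⊆ Y → ∀ u → degMinus G Y u ≤ degMinus G Z u
  degMinus-antitone {Z} {Y} Z⊆Y u = sumFin-mono pointwise
    where
    pointwise : ∀ v → indicator (adj G u v ∧ not (lookup Y v)) ≤ indicator (adj G u v ∧ not (lookup Z v))
    pointwise v with adj G u v | lookup Z v in z | lookup Y v in y
    ... | false | _     | _     = z≤n
    ... | true  | _     | true  = z≤n
    ... | true  | false | false = s≤s z≤n
    ... | true  | true  | false with trans (sym (∈⇒lookup (Z⊆Y (lookup⇒∈ z)))) y
    ...   | ()

  nbrs-pos : ∀ {A u x} → x ∈ A → adj G u x ≡ true → 1 ≤ nbrs A u
  nbrs-pos {A} {u} {x} x∈A ux =
    ℕₚ.≤-trans (ℕₚ.≤-reflexive (cong indicator (sym edge)))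
               (sumFin-term (λ v → indicator (adj G u v ∧ lookup A v)) x)
    where
    edge : adj G u x ∧ lookup A x ≡ true
    edge rewrite ux = ∈⇒lookup x∈A

  cross-pairs : ∀ Z A → cross Z A ≡ sumFin² (λ u v → indicator (lookup Z u ∧ (adj G u v ∧ lookup A v)))
  cross-pairs Z A = sumFin-cong pointwise
    where
    pointwise : ∀ u → (if lookup Z u then nbrs A u else 0)
                    ≡ sumFin (λ v → indicator (lookup Z u ∧ (adj G u v ∧ lookup A v)))
    pointwise u with lookup Z u
    ... | true  = refl
    ... | false = sym (sumFin-zeros {n} (λ _ → 0) (λ _ → refl))

  cross-sym : ∀ Z A → cross Z A ≡ cross A Z
  cross-sym Z A = begin
    cross Z A
      ≡⟨ cross-pairs Z A ⟩
    sumFin² (λ u v → indicator (lookup Z u ∧ (adj G u v ∧ lookup A v)))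
      ≡⟨ sumFin²-swap {n} {n} _ ⟩
    sumFin² (λ v u → indicator (lookup Z u ∧ (adj G u v ∧ lookup A v)))
      ≡⟨ sumFin-cong (λ v → sumFin-cong (reverse v)) ⟩
    sumFin² (λ v u → indicator (lookup A v ∧ (adj G v u ∧ lookup Z u)))
      ≡⟨ sym (cross-pairs A Z) ⟩
    cross A Z ∎
    where
    open ≡-Reasoning
    swap-ends : ∀ x a y → x ∧ (a ∧ y) ≡ y ∧ (a ∧ x)
    swap-ends true  a true  = refl
    swap-ends true  a false = Boolₚ.∧-zeroʳ a
    swap-ends false a true  = sym (Boolₚ.∧-zeroʳ a)
    swap-ends false a false = refl
    reverse : ∀ v u → indicator (lookup Z u ∧ (adj G u v ∧ lookup A v))
                    ≡ indicator (lookup A v ∧ (adj G v u ∧ lookup Z u))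
    reverse v u rewrite Graph.sym G v u = cong indicator (swap-ends (lookup Z u) (adj G u v) (lookup A v))

  meets : Subset n → Fin n → Fin n → ℕ
  meets X u v = indicator (adj G u v ∧ (lookup X u ∨ lookup X v))

  -- ē counts every edge meeting X once, in its orientation with toℕ u < toℕ v;
  -- adding the reversed orientation counts every such ordered pair.
  orientations : ∀ X u v →
    indicator ((toℕ u <ᵇ toℕ v) ∧ adj G u v ∧ (lookup X u ∨ lookup X v))
    + indicator ((toℕ v <ᵇ toℕ u) ∧ adj G v u ∧ (lookup X v ∨ lookup X u)) ≡ meets X u v
  orientations X u v
    with toℕ u <ᵇ toℕ v | ℕₚ.<ᵇ-reflects-< (toℕ u) (toℕ v)
       | toℕ v <ᵇ toℕ u | ℕₚ.<ᵇ-reflects-< (toℕ v) (toℕ u)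
  ... | true  | ofʸ u<v | true  | ofʸ v<u = ⊥-elim (ℕₚ.<-asym u<v v<u)
  ... | true  | _       | false | _       = ℕₚ.+-identityʳ _
  ... | false | _       | true  | _       rewrite Graph.sym G v u | Boolₚ.∨-comm (lookup X v) (lookup X u) = refl
  ... | false | ofⁿ u≮v | false | ofⁿ v≮u
    with Finₚ.toℕ-injective (ℕₚ.≤-antisym (ℕₚ.≮⇒≥ v≮u) (ℕₚ.≮⇒≥ u≮v))
  ...   | refl rewrite Graph.irrefl G u = refl

  ebar-doubled : ∀ X → ebar G X * 2 ≡ sumFin² (meets X)
  ebar-doubled X = begin
    ebar G X * 2                         ≡⟨ twice (ebar G X) ⟩
    sumFin² once + sumFin² once          ≡⟨ cong (λ s → sumFin² once + s) (sumFin²-swap once) ⟩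
    sumFin² once + sumFin² (λ u v → once v u)  ≡⟨ sym (sumFin²-+ once (λ u v → once v u)) ⟩
    sumFin² (λ u v → once u v + once v u)     ≡⟨ sumFin-cong (λ u → sumFin-cong (orientations X u)) ⟩
    sumFin² (meets X)                    ∎
    where
    open ≡-Reasoning
    once : Fin n → Fin n → ℕ
    once u v = indicator ((toℕ u <ᵇ toℕ v) ∧ adj G u v ∧ (lookup X u ∨ lookup X v))

  -- An ordered pair meeting X either starts in X, or starts outside X and ends in X.
  meets-split : ∀ X → sumFin² (meets X) ≡ sumOver X (deg G) + sumOver X (degMinus G X)
  meets-split X = begin
    sumFin² (meets X)
      ≡⟨ sumFin-cong (λ u → sumFin-cong (pointwise u)) ⟩
    sumFin² (λ u v → fromStart u v + fromEnd u v)
      ≡⟨ sumFin²-+ fromStart fromEnd ⟩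
    sumFin² fromStart + sumFin² fromEnd
      ≡⟨ cong (λ s → sumFin² fromStart + s) (sumFin²-swap fromEnd) ⟩
    sumFin² fromStart + sumFin² (λ v u → fromEnd u v)
      ≡⟨ cong₂ _+_ (sumFin-cong (λ u → sumFin-if {n} (lookup X u) _))
                   (sumFin-cong (λ v → sumFin-if {n} (lookup X v) _)) ⟩
    sumOver X (deg G) + sumOver X (degMinus G X) ∎
    where
    open ≡-Reasoning
    fromStart fromEnd : Fin n → Fin n → ℕ
    fromStart u v = if lookup X u then indicator (adj G u v) else 0
    fromEnd   u v = if lookup X v then indicator (adj G v u ∧ not (lookup X u)) else 0
    truth-table : ∀ a x y → indicator (a ∧ (x ∨ y))
                          ≡ (if x then indicator a else 0) + (if y then indicator (a ∧ not x) else 0)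
    truth-table true  true  true  = refl
    truth-table true  true  false = refl
    truth-table true  false true  = refl
    truth-table true  false false = refl
    truth-table false true  true  = refl
    truth-table false true  false = refl
    truth-table false false true  = refl
    truth-table false false false = refl
    pointwise : ∀ u v → meets X u v ≡ fromStart u v + fromEnd u v
    pointwise u v rewrite Graph.sym G v u = truth-table (adj G u v) (lookup X u) (lookup X v)

  handshake : ∀ X → ebar G X * 2 ≡ sumOver X (λ u → deg G u + degMinus G X u)
  handshake X = trans (ebar-doubled X) (trans (meets-split X) (sym (sumOver-+ X (deg G) (degMinus G X))))

  incidences-∪ : ∀ {Z A} → Disjoint Z A →
    sumOver Z (λ u → deg G u + degMinus G (Z ∪ A) u) + cross Z A
    ≡ sumOver Z (λ u → deg G u + degMinus G Z u)
  incidences-∪ {Z} {A} Z#A = trans (sym (sumOver-+ Z _ (nbrs A))) (sumOver-cong Z regroup)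
    where
    regroup : ∀ u → u ∈ Z → deg G u + degMinus G (Z ∪ A) u + nbrs A u ≡ deg G u + degMinus G Z u
    regroup u _ = trans (ℕₚ.+-assoc (deg G u) _ _) (cong (λ s → deg G u + s) (degMinus-∪ Z#A u))

  ebar-∪ : ∀ {Z A} → Disjoint Z A → ebar G (Z ∪ A) + cross Z A ≡ ebar G Z + ebar G A
  ebar-∪ {Z} {A} Z#A = ℕₚ.*-cancelʳ-≡ _ _ 2 (begin
    (ebar G (Z ∪ A) + cross Z A) * 2
      ≡⟨ double-sum (ebar G (Z ∪ A)) (cross Z A) ⟩
    ebar G (Z ∪ A) * 2 + (cross Z A + cross Z A)
      ≡⟨ cong₂ _+_ (handshake (Z ∪ A)) (cong (λ s → cross Z A + s) (cross-sym Z A)) ⟩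
    sumOver (Z ∪ A) inc∪ + (cross Z A + cross A Z)
      ≡⟨ cong (_+ (cross Z A + cross A Z)) (sumOver-∪ inc∪ Z#A) ⟩
    sumOver Z inc∪ + sumOver A inc∪ + (cross Z A + cross A Z)
      ≡⟨ interchange (sumOver Z inc∪) (sumOver A inc∪) (cross Z A) (cross A Z) ⟩
    (sumOver Z inc∪ + cross Z A) + (sumOver A inc∪ + cross A Z)
      ≡⟨ cong₂ _+_ (incidences-∪ Z#A) incidences-A ⟩
    sumOver Z (λ u → deg G u + degMinus G Z u) + sumOver A (λ u → deg G u + degMinus G A u)
      ≡⟨ sym (cong₂ _+_ (handshake Z) (handshake A)) ⟩
    ebar G Z * 2 + ebar G A * 2
      ≡⟨ sym (ℕₚ.*-distribʳ-+ 2 (ebar G Z) (ebar G A)) ⟩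
    (ebar G Z + ebar G A) * 2 ∎)
    where
    open ≡-Reasoning
    inc∪ : Fin n → ℕ
    inc∪ u = deg G u + degMinus G (Z ∪ A) u
    incidences-A : sumOver A inc∪ + cross A Z ≡ sumOver A (λ u → deg G u + degMinus G A u)
    incidences-A rewrite Subsetₚ.∪-comm Z A = incidences-∪ (disjoint-sym Z#A)
    double-sum : ∀ a b → (a + b) * 2 ≡ a * 2 + (b + b)
    double-sum = solve-∀
    interchange : ∀ a b c d → a + b + (c + d) ≡ (a + c) + (b + d)
    interchange = solve-∀

  degMinus-⁅self⁆ : ∀ v → degMinus G ⁅ v ⁆ v ≡ deg G v
  degMinus-⁅self⁆ v = sumFin-cong pointwise
    where
    pointwise : ∀ u → indicator (adj G v u ∧ not (lookup ⁅ v ⁆ u)) ≡ indicator (adj G v u)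
    pointwise u with u ≟ v
    ... | yes refl rewrite Graph.irrefl G u = refl
    ... | no u≢v   rewrite ∉⇒lookup (Subsetₚ.x≢y⇒x∉⁅y⁆ u≢v) = cong indicator (Boolₚ.∧-identityʳ _)

  ebar-⁅⁆ : ∀ v → ebar G ⁅ v ⁆ ≡ deg G v
  ebar-⁅⁆ v = ℕₚ.*-cancelʳ-≡ _ _ 2 (begin
    ebar G ⁅ v ⁆ * 2                                   ≡⟨ handshake ⁅ v ⁆ ⟩
    sumOver ⁅ v ⁆ (λ u → deg G u + degMinus G ⁅ v ⁆ u)  ≡⟨ sumOver-⁅⁆ _ v ⟩
    deg G v + degMinus G ⁅ v ⁆ v                       ≡⟨ cong (λ s → deg G v + s) (degMinus-⁅self⁆ v) ⟩
    deg G v + deg G v                                  ≡⟨ sym (twice (deg G v)) ⟩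
    deg G v * 2                                        ∎)
    where open ≡-Reasoning

∸-+-≡-⊔ : ∀ m d → m ∸ d + d ≡ m ⊔ d
∸-+-≡-⊔ m d with d ≤? m
... | yes d≤m = trans (ℕₚ.m∸n+n≡m d≤m) (sym (ℕₚ.m≥n⇒m⊔n≡m d≤m))
... | no  d≰m = let m≤d = ℕₚ.<⇒≤ (ℕₚ.≰⇒> d≰m) in
  trans (cong (_+ d) (ℕₚ.m≤n⇒m∸n≡0 m≤d)) (sym (ℕₚ.m≤n⇒m⊔n≡n m≤d))

module Budget (k : ℕ) {n : ℕ} (G : Graph n) where
  open Counting G

  c : ℕ
  c = k ∸ 1

  c+1≡k : 1 ≤ k → c + 1 ≡ k
  c+1≡k = ℕₚ.m∸n+n≡m

  suc-c≡k : 1 ≤ k → suc c ≡ k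
  suc-c≡k 1≤k = ℕₚ.suc-pred k {{>-nonZero 1≤k}}

  c<k : 1 ≤ k → c < k
  c<k 1≤k = ℕₚ.≤-reflexive (suc-c≡k 1≤k)

  deficit : Subset n → ℕ
  deficit X = sumOver X (λ u → k ∸ deg G u)

  -- The inequality of the lemma for X, with ē(X) moved to the left.
  Bounded : Subset n → Set
  Bounded X = deficit X + ebar G X ≤ c * ∣ X ∣ + 1

  Cheap : Subset n → Subset n → Set
  Cheap Z A = deficit A + ebar G A ≤ c * ∣ A ∣ + cross Z A

  Bounded-∪ : ∀ {Z A} → Disjoint Z A → Bounded Z → Cheap Z A → Bounded (Z ∪ A)
  Bounded-∪ {Z} {A} Z#A bounded cheap = ℕₚ.+-cancelʳ-≤ (cross Z A) _ _ (begin
    deficit (Z ∪ A) + ebar G (Z ∪ A) + cross Z A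
      ≡⟨ cong (λ d → d + ebar G (Z ∪ A) + cross Z A) (sumOver-∪ _ Z#A) ⟩
    deficit Z + deficit A + ebar G (Z ∪ A) + cross Z A
      ≡⟨ ℕₚ.+-assoc (deficit Z + deficit A) _ _ ⟩
    deficit Z + deficit A + (ebar G (Z ∪ A) + cross Z A)
      ≡⟨ cong (λ e → deficit Z + deficit A + e) (ebar-∪ Z#A) ⟩
    deficit Z + deficit A + (ebar G Z + ebar G A)
      ≡⟨ interchange (deficit Z) (deficit A) (ebar G Z) (ebar G A) ⟩
    (deficit Z + ebar G Z) + (deficit A + ebar G A)
      ≤⟨ ℕₚ.+-mono-≤ bounded cheap ⟩
    (c * ∣ Z ∣ + 1) + (c * ∣ A ∣ + cross Z A)
      ≡⟨ regroup c ∣ Z ∣ ∣ A ∣ (cross Z A) ⟩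
    c * (∣ Z ∣ + ∣ A ∣) + 1 + cross Z A
      ≡⟨ cong (λ s → c * s + 1 + cross Z A) (sym (∣∪∣ Z#A)) ⟩
    c * ∣ Z ∪ A ∣ + 1 + cross Z A ∎)
    where
    open ℕₚ.≤-Reasoning
    interchange : ∀ a b x y → a + b + (x + y) ≡ (a + x) + (b + y)
    interchange = solve-∀
    regroup : ∀ c z a e → (c * z + 1) + (c * a + e) ≡ c * (z + a) + 1 + e
    regroup = solve-∀

  vertex-budget : ∀ d dm m → d ≡ dm + m → dm < k → 1 ≤ m → k ∸ d + d ≤ c * 1 + m
  vertex-budget d dm m d≡ dm<k 1≤m rewrite ∸-+-≡-⊔ k d | ℕₚ.*-identityʳ c =
    ℕₚ.⊔-lub k≤ (subst (_≤ c + m) (sym d≡) (ℕₚ.+-monoˡ-≤ m (ℕₚ.<⇒≤pred dm<k)))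
    where
    k≤ : k ≤ c + m
    k≤ = subst (_≤ c + m) (c+1≡k (ℕₚ.≤-trans (s≤s z≤n) dm<k)) (ℕₚ.+-monoʳ-≤ c 1≤m)

  vertex-cheap : ∀ {Z v u} → u ∈ Z → adj G v u ≡ true → degMinus G Z v < k → Cheap Z ⁅ v ⁆
  vertex-cheap {Z} {v} {u} u∈Z vu dm<k =
    subst₂ _≤_ (cong₂ _+_ (sym (sumOver-⁅⁆ _ v)) (sym (ebar-⁅⁆ v)))
               (cong₂ _+_ (cong (c *_) (sym (Subsetₚ.∣⁅x⁆∣≡1 v))) inside)
               (vertex-budget (deg G v) (degMinus G Z v) (nbrs Z v) (degree-split Z v) dm<k (nbrs-pos u∈Z vu))
    where
    inside : nbrs Z v ≡ cross Z ⁅ v ⁆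
    inside = trans (sym (sumOver-⁅⁆ (nbrs Z) v)) (cross-sym ⁅ v ⁆ Z)

  class-cheap : ∀ {Z D x u} → (∀ v → v ∈ D → k ≤ deg G v) → ebar G D ≤ c * ∣ D ∣ + 1 →
    x ∈ D → u ∈ Z → adj G x u ≡ true → Cheap Z D
  class-cheap {Z} {D} {x} {u} high sparse x∈D u∈Z xu =
    subst (_≤ c * ∣ D ∣ + cross Z D) (cong (_+ ebar G D) (sym no-deficit))
          (ℕₚ.≤-trans sparse (ℕₚ.+-monoʳ-≤ (c * ∣ D ∣) joined))
    where
    no-deficit : deficit D ≡ 0
    no-deficit = sumOver-vanishes D (λ v v∈D → ℕₚ.m≤n⇒m∸n≡0 (high v v∈D))
    joined : 1 ≤ cross Z D
    joined = ℕₚ.≤-trans (nbrs-pos x∈D (trans (Graph.sym G u x) xu)) (sumOver-term (nbrs D) u∈Z)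

  root-bounded : ∀ {w} → 1 ≤ k → deg G w ≤ c → Bounded ⁅ w ⁆
  root-bounded {w} 1≤k low rewrite sumOver-⁅⁆ (λ u → k ∸ deg G u) w | ebar-⁅⁆ w | Subsetₚ.∣⁅x⁆∣≡1 w
    | ℕₚ.m∸n+n≡m (ℕₚ.≤-trans low (ℕₚ.m∸n≤m k 1)) | ℕₚ.*-identityʳ c =
    ℕₚ.≤-reflexive (sym (c+1≡k 1≤k))

  -- The sum in the lemma ranges over s with deg s ≤ k - 1; the other terms vanish anyway.
  deficitSum≡deficit : 1 ≤ k → ∀ X → deficitSum k G X ≡ deficit X
  deficitSum≡deficit 1≤k X = sumFin-cong pointwise
    where
    pointwise : ∀ s → (if lookup X s ∧ (deg G s ≤ᵇ c) then k ∸ deg G s else 0)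
                    ≡ (if lookup X s then k ∸ deg G s else 0)
    pointwise s with lookup X s | deg G s ≤ᵇ c | ℕₚ.≤ᵇ-reflects-≤ (deg G s) c
    ... | false | _     | _       = refl
    ... | true  | true  | _       = refl
    ... | true  | false | ofⁿ d≰c = sym (ℕₚ.m≤n⇒m∸n≡0 (subst (_≤ deg G s) (suc-c≡k 1≤k) (ℕₚ.≰⇒> d≰c)))

module Shadow
  (k : ℕ) (1≤k : 1 ≤ k) {n : ℕ} (G : Graph n) (𝒞 : Subset n → Set)
  (classes-disjoint : ∀ D D' → 𝒞 D → 𝒞 D' → D ≢ D' → Disjoint D D')
  (classes-nonempty : ∀ D → 𝒞 D → ∃ λ x → x ∈ D)
  (classes-sparse : ∀ D → 𝒞 D → ebar G D ≤ (k ∸ 1) * ∣ D ∣ + 1)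
  (classes-high : ∀ D → 𝒞 D → ∀ v → v ∈ D → k ≤ deg G v)
  (w : Fin n) (w-low : deg G w ≤ k ∸ 1)
  (Y : Subset n) (Y-shadow : IsShadow k G 𝒞 w Y) where

  open Counting G
  open Budget k G

  w∈Y : w ∈ Y
  w∈Y = proj₁ (proj₁ Y-shadow)

  Y-vertices : ∀ v → v ∉ Y → AdjTo G v Y → k ≤ degMinus G Y v
  Y-vertices = proj₁ (proj₂ (proj₂ (proj₁ Y-shadow)))

  Y-classes : ∀ D → 𝒞 D → (∃ λ x → x ∈ D × AdjTo G x Y) → D ⊆ Y
  Y-classes = proj₂ (proj₂ (proj₂ (proj₁ Y-shadow)))

  Y-minimal : ∀ Z → ShadowConds k G 𝒞 w Z → Z ⊆ Y → Y ⊆ Z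
  Y-minimal = proj₂ Y-shadow

  Respects : Subset n → Set
  Respects Z = ∀ D → 𝒞 D → D ⊆ Z ⊎ Disjoint D Z

  record Stage (Z : Subset n) : Set where
    field
      below    : Z ⊆ Y
      root     : w ∈ Z
      respects : Respects Z
      bounded  : Bounded Z

  Growable : Subset n → Set
  Growable Z = ∃ λ Z' → Z ⊂ Z' × Stage Z'

  respects-∪ : ∀ {Z A} → Respects Z → (∀ D → 𝒞 D → Disjoint D Z → D ⊆ A ⊎ Disjoint D A) →
    Respects (Z ∪ A)
  respects-∪ {Z} {A} rZ rA D cD with rZ D cD
  ... | inj₁ D⊆Z = inj₁ (λ x∈D → Subsetₚ.p⊆p∪q A (D⊆Z x∈D))
  ... | inj₂ D#Z with rA D cD D#Z
  ...   | inj₁ D⊆A = inj₁ (λ x∈D → Subsetₚ.q⊆p∪q Z A (D⊆A x∈D))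
  ...   | inj₂ D#A = inj₂ (λ x x∈D x∈Z∪A → [ D#Z x x∈D , D#A x x∈D ]′ (Subsetₚ.x∈p∪q⁻ Z A x∈Z∪A))

  grow : ∀ {Z A} → Stage Z → A ⊆ Y → Disjoint A Z → (∃ λ x → x ∈ A) →
    (∀ D → 𝒞 D → Disjoint D Z → D ⊆ A ⊎ Disjoint D A) → Cheap Z A → Growable Z
  grow {Z} {A} st A⊆Y A#Z (x , x∈A) rA cheap =
    Z ∪ A , (Subsetₚ.p⊆p∪q A , x , Subsetₚ.q⊆p∪q Z A x∈A , A#Z x x∈A) , record
      { below    = λ y∈Z∪A → [ below , A⊆Y ]′ (Subsetₚ.x∈p∪q⁻ Z A y∈Z∪A)
      ; root     = Subsetₚ.p⊆p∪q A root
      ; respects = respects-∪ respects rA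
      ; bounded  = Bounded-∪ (disjoint-sym A#Z) bounded cheap
      }
    where open Stage st

  class-growth : ∀ {Z D} → Stage Z → 𝒞 D → (∃ λ x → x ∈ D × AdjTo G x Z) → Disjoint D Z → Growable Z
  class-growth {Z} {D} st cD (x , x∈D , u , u∈Z , xu) D#Z =
    grow st D⊆Y D#Z (classes-nonempty D cD) only-D
      (class-cheap (classes-high D cD) (classes-sparse D cD) x∈D u∈Z xu)
    where
    open Stage st
    D⊆Y : D ⊆ Y
    D⊆Y = Y-classes D cD (x , x∈D , u , below u∈Z , xu)
    only-D : ∀ D' → 𝒞 D' → Disjoint D' Z → D' ⊆ D ⊎ Disjoint D' D
    only-D D' cD' _ with Vecₚ.≡-dec Boolₚ._≟_ D' D
    ... | yes refl  = inj₁ (λ y∈D → y∈D)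
    ... | no  D'≢D  = inj₂ (classes-disjoint D' D cD' cD D'≢D)

  vertex-growth : ∀ {Z v} → Stage Z → v ∉ Z → v ∈ Y → AdjTo G v Z → degMinus G Z v < k →
    ¬ (∃ λ D → 𝒞 D × v ∈ D) → Growable Z
  vertex-growth {Z} {v} st v∉Z v∈Y (u , u∈Z , vu) dm<k unclassed =
    grow st ⁅v⁆⊆Y ⁅v⁆#Z (v , Subsetₚ.x∈⁅x⁆ v) avoids (vertex-cheap u∈Z vu dm<k)
    where
    ⁅v⁆⊆Y : ⁅ v ⁆ ⊆ Y
    ⁅v⁆⊆Y x∈⁅v⁆ with Subsetₚ.x∈⁅y⁆⇒x≡y v x∈⁅v⁆
    ... | refl = v∈Y
    ⁅v⁆#Z : Disjoint ⁅ v ⁆ Z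
    ⁅v⁆#Z x x∈⁅v⁆ with Subsetₚ.x∈⁅y⁆⇒x≡y v x∈⁅v⁆
    ... | refl = v∉Z
    avoids : ∀ D → 𝒞 D → Disjoint D Z → D ⊆ ⁅ v ⁆ ⊎ Disjoint D ⁅ v ⁆
    avoids D cD _ = inj₂ λ x x∈D x∈⁅v⁆ → unclassed (D , cD , subst (_∈ D) (Subsetₚ.x∈⁅y⁆⇒x≡y v x∈⁅v⁆) x∈D)

  stuck⇒conditions : ∀ {Z} → Stage Z → ¬ Growable Z → ShadowConds k G 𝒞 w Z
  stuck⇒conditions {Z} st stuck = root , respects , closed-vertices , closed-classes
    where
    open Stage st
    -- (IV): a class joined to Z but not inside Z could be added.
    closed-classes : ∀ D → 𝒞 D → (∃ λ x → x ∈ D × AdjTo G x Z) → D ⊆ Z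
    closed-classes D cD joined with respects D cD
    ... | inj₁ D⊆Z = D⊆Z
    ... | inj₂ D#Z = ⊥-elim (stuck (class-growth st cD joined D#Z))
    -- (III): a vertex outside Y has ≥ k neighbours outside Y ⊇ Z by (III) for Y;
    -- a vertex of Y with fewer could be added, as a class or as a single vertex.
    closed-vertices : ∀ v → v ∉ Z → AdjTo G v Z → k ≤ degMinus G Z v
    closed-vertices v v∉Z (u , u∈Z , vu) with k ≤? degMinus G Z v | v Subsetₚ.∈? Y
    ... | yes k≤dm | _      = k≤dm
    ... | no  k≰dm | no v∉Y =
      ⊥-elim (k≰dm (ℕₚ.≤-trans (Y-vertices v v∉Y (u , below u∈Z , vu)) (degMinus-antitone below v)))
    ... | no  k≰dm | yes v∈Y =
      ⊥-elim (stuck (vertex-growth st v∉Z v∈Y (u , u∈Z , vu) (ℕₚ.≰⇒> k≰dm) unclassed))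
      where
      unclassed : ¬ (∃ λ D → 𝒞 D × v ∈ D)
      unclassed (D , cD , v∈D) = v∉Z (closed-classes D cD (v , v∈D , u , u∈Z , vu) v∈D)

  -- By minimality of the shadow, a stage other than Y can (classically) be grown.
  growable : ∀ {Z} → Stage Z → Z ≢ Y → ¬ ¬ Growable Z
  growable st Z≢Y stuck =
    Z≢Y (Subsetₚ.⊆-antisym below (Y-minimal _ (stuck⇒conditions st stuck) below))
    where open Stage st

  reaches-Y : ∀ {Z} → Acc _⊃_ Z → Stage Z → ¬ ¬ Bounded Y
  reaches-Y {Z} (acc larger) st with Vecₚ.≡-dec Boolₚ._≟_ Z Y
  ... | yes refl = λ unbounded → unbounded (Stage.bounded st)
  ... | no  Z≢Y  = λ unbounded →
    growable st Z≢Y (λ (Z' , Z⊂Z' , st') → reaches-Y (larger Z⊂Z') st' unbounded)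

  initial-stage : Stage ⁅ w ⁆
  initial-stage = record
    { below    = λ x∈⁅w⁆ → subst (_∈ Y) (sym (Subsetₚ.x∈⁅y⁆⇒x≡y w x∈⁅w⁆)) w∈Y
    ; root     = Subsetₚ.x∈⁅x⁆ w
    ; respects = λ D cD → inj₂ (unclassed D cD)
    ; bounded  = root-bounded 1≤k w-low
    }
    where
    -- Class vertices have degree at least k, while deg w ≤ k - 1.
    unclassed : ∀ D → 𝒞 D → Disjoint D ⁅ w ⁆
    unclassed D cD x x∈D x∈⁅w⁆ with Subsetₚ.x∈⁅y⁆⇒x≡y w x∈⁅w⁆
    ... | refl = ℕₚ.<⇒≱ (ℕₚ.≤-<-trans w-low (c<k 1≤k)) (classes-high D cD w x∈D)

  shadow-bounded : Bounded Y
  shadow-bounded = decidable-stable (_ ≤? _) (reaches-Y (⊃-wellFounded ⁅ w ⁆) initial-stage)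

integer-form : ∀ {a e p} → a + e ≤ p + 1 → + a ≤ℤ (+ p - + e) +ℤ + 1
integer-form {a} {e} {p} a+e≤p+1 = begin
  + a                        ≡⟨ cancel (+ a) (+ e) ⟩
  + (a + e) - + e            ≤⟨ ℤₚ.+-monoˡ-≤ (ℤ.- + e) (ℤ.+≤+ a+e≤p+1) ⟩
  + (p + 1) - + e            ≡⟨ regroup (+ p) (+ e) ⟩
  (+ p - + e) +ℤ + 1         ∎
  where
  open ℤₚ.≤-Reasoning
  cancel : ∀ (x y : ℤ) → x ≡ (x +ℤ y) - y
  cancel = ℤ-Solver.solve-∀
  regroup : ∀ (x y : ℤ) → (x +ℤ + 1) - y ≡ (x - y) +ℤ + 1
  regroup = ℤ-Solver.solve-∀

lemma4p10 : (k : ℕ) → 2 ≤ k → (n : ℕ) → (G : Graph n) → (𝒞 : Subset n → Set)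
    → (∀ D D' → 𝒞 D → 𝒞 D' → D ≢ D' → Disjoint D D')
    → (∀ D → 𝒞 D → ∃ λ x → x ∈ D)
    → (∀ D → 𝒞 D → ebar G D ≤ (k ∸ 1) * ∣ D ∣ + 1)
    → (∀ D → 𝒞 D → ∀ v → v ∈ D → k ≤ deg G v)
    → (w : Fin n) → deg G w ≤ k ∸ 1
    → (Y : Subset n) → IsShadow k G 𝒞 w Y
    → + deficitSum k G Y ≤ℤ (+ ((k ∸ 1) * ∣ Y ∣) - + ebar G Y) +ℤ + 1
lemma4p10 k 2≤k n G 𝒞 disjoint nonempty sparse high w w-low Y shadow =
  integer-form (subst (λ d → d + ebar G Y ≤ c * ∣ Y ∣ + 1) (sym (deficitSum≡deficit 1≤k Y)) Y-bounded)
  where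
  open Budget k G using (c; Bounded; deficitSum≡deficit)
  1≤k : 1 ≤ k
  1≤k = ℕₚ.≤-trans (s≤s z≤n) 2≤k
  Y-bounded : Bounded Y
  Y-bounded = Shadow.shadow-bounded k 1≤k G 𝒞 disjoint nonempty sparse high w w-low Y shadow
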